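{- Let $F$ be a finite field with $\operatorname{char}(F)\neq 2$ and let $n$ be a positive integer. Then $\mathcal{S}_n=\{\operatorname{diag}(a_1,\ldots,a_n)\mid a_i=\pm1\}$ is a maximal independent set of the unit graph $\Gamma'(M_n(F))$.
   Context: $M_n(F)$ is the ring of $n\times n$ matrices over $F$. The unit graph $\Gamma'(S)$ of a ring $S$ has vertex set $S$, two distinct vertices $x,y$ adjacent iff $x+y$ is a unit of $S$. -}

module Defs where

open import Level using (Level; _⊔_)
import Level
open import Data.Nat using (ℕ; zero; suc)
open import Data.Fin using (Fin; zero; suc)
import Data.Fin as Fin
open import Data.Bool using (Bool; true; false; if_then_else_)
open import Data.List using (List)
open import Data.List.Relation.Unary.Any using (Any)
open import Data.Product using (Σ; ∃; _×_; _,_)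
open import Relation.Nullary using (¬_; Dec; does)
open import Relation.Binary using (Decidable)
open import Algebra.Bundles using (CommutativeRing)

record IsFiniteField {c ℓ : Level} (R : CommutativeRing c ℓ) : Set (c ⊔ ℓ) where
  open CommutativeRing R hiding (zero)
  field
    nontrivial : ¬ (1# ≈ 0#)
    inverse    : ∀ x → ¬ (x ≈ 0#) → ∃ λ y → x * y ≈ 1#
    -- finiteness: an explicit list containing every element (up to ≈),
    -- together with decidable equality (as for any finite type)
    enum       : List Carrier
    complete   : ∀ x → Any (x ≈_) enum
    _≟_        : Decidable _≈_

CharNot2 : {c ℓ : Level} (R : CommutativeRing c ℓ) → Set ℓ
CharNot2 R = ¬ (1# + 1# ≈ 0#)
  where open CommutativeRing R

module MatrixOps {c ℓ : Level} (R : CommutativeRing c ℓ) where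
  open CommutativeRing R hiding (zero)

  Mat : ℕ → Set c
  Mat n = Fin n → Fin n → Carrier

  _≈ᴹ_ : {n : ℕ} → Mat n → Mat n → Set ℓ
  A ≈ᴹ B = ∀ i j → A i j ≈ B i j

  ∑ : {n : ℕ} → (Fin n → Carrier) → Carrier
  ∑ {zero}  f = 0#
  ∑ {suc n} f = f zero + ∑ (λ i → f (suc i))

  _+ᴹ_ : {n : ℕ} → Mat n → Mat n → Mat n
  (A +ᴹ B) i j = A i j + B i j

  _*ᴹ_ : {n : ℕ} → Mat n → Mat n → Mat n
  (A *ᴹ B) i j = ∑ (λ k → A i k * B k j)

  Iᴹ : {n : ℕ} → Mat n
  Iᴹ i j = if does (i Fin.≟ j) then 1# else 0#

  IsUnit : {n : ℕ} → Mat n → Set (c ⊔ ℓ)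
  IsUnit {n} A = Σ (Mat n) λ B → (A *ᴹ B) ≈ᴹ Iᴹ × (B *ᴹ A) ≈ᴹ Iᴹ

  Adjacent : {n : ℕ} → Mat n → Mat n → Set (c ⊔ ℓ)
  Adjacent A B = ¬ (A ≈ᴹ B) × IsUnit (A +ᴹ B)

  -- a set of vertices, given by a membership predicate
  -- (used up to ≈ᴹ: all predicates below respect ≈ᴹ)
  IsIndependent : {n : ℕ} → (Mat n → Set (c ⊔ ℓ)) → Set (c ⊔ ℓ)
  IsIndependent S = ∀ A B → S A → S B → ¬ Adjacent A B

  IsMaximalIndependent : {n : ℕ} → (Mat n → Set (c ⊔ ℓ)) → Set (c ⊔ ℓ)
  IsMaximalIndependent {n} S =
    IsIndependent S ×
    (∀ A → ¬ S A → Σ (Mat n) λ B → S B × Adjacent A B)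

  signDiag : {n : ℕ} → (Fin n → Bool) → Mat n
  signDiag s i j = if does (i Fin.≟ j) then (if s i then 1# else - 1#) else 0#

  𝒮 : (n : ℕ) → Mat n → Set (c ⊔ ℓ)
  𝒮 n A = Level.Lift c (Σ (Fin n → Bool) λ s → A ≈ᴹ signDiag s)

{-# OPTIONS --safe #-}
module Submission where

-- Two distinct sign matrices differ in some entry i, and then the i-th row of their sum
-- vanishes, so the sum is not a unit: 𝒮ₙ is independent.  For maximality, every matrix A
-- has signs making A + diag(±1) invertible.  By induction the signs of the lower-right
-- (n-1)×(n-1) block N can be chosen so that N has an inverse P.  The first sign changes the
-- Schur complement σ = a₁₁ ± 1 − r P c of that block by 2 ≠ 0, so one choice makes σ a unit,
-- and then the block factorisation  M = [1, rP; 0, I] · diag(σ, N) · [1, 0; Pc, I]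
-- exhibits M as a product of units.

open import Defs
open import Level using (Level)
open import Data.Nat using (ℕ; _≥_)
open import Algebra.Bundles using (CommutativeRing)

open import Level using (lift)
open import Data.Nat using (zero; suc)
open import Data.Fin using (Fin; zero; suc)
import Data.Fin as Fin
open import Data.Bool using (Bool; true; false)
import Data.Bool as Bool
open import Data.Vec.Functional using (Vector; _∷_; map; zipWith)
import Data.Vec.Functional.Relation.Binary.Equality.Setoid as VectorEquality
open import Data.Product using (Σ; _×_; _,_)
open import Data.Empty using (⊥-elim)
open import Function using (_∘_)
open import Relation.Binary.Bundles using (Setoid)
import Relation.Binary.Reasoning.Setoid as SetoidReasoning
open import Relation.Nullary using (¬_; yes; no; does)
open import Relation.Binary.PropositionalEquality using (_≡_; _≢_)
import Relation.Binary.PropositionalEquality as ≡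

module MatrixProperties {r₁ r₂ : Level} (R : CommutativeRing r₁ r₂) where
  open CommutativeRing R hiding (zero)
  open MatrixOps R
  open import Algebra.Properties.Semiring.Sum semiring
    using (sum; sum-cong-≋; sum-replicate-zero; ∑-comm; *-distribˡ-sum; *-distribʳ-sum)
  open import Algebra.Properties.Group +-group using (//-rightDividesˡ; x∙y⁻¹≈ε⇒x≈y; ∙-cancelˡ)
  module ≈-Reasoning = SetoidReasoning setoid
  open VectorEquality setoid using (_≋_; ≋-refl)

  +-cong-identityˡ : ∀ {x y z} → x ≈ 0# → y ≈ z → x + y ≈ z
  +-cong-identityˡ {z = z} x≈0 y≈z = trans (+-cong x≈0 y≈z) (+-identityˡ z)

  +-cong-identityʳ : ∀ {x y z} → x ≈ z → y ≈ 0# → x + y ≈ z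
  +-cong-identityʳ {z = z} x≈z y≈0 = trans (+-cong x≈z y≈0) (+-identityʳ z)

  ∑≈sum : ∀ {n} (f : Vector Carrier n) → ∑ f ≈ sum f
  ∑≈sum {zero}  f = refl
  ∑≈sum {suc n} f = +-congˡ (∑≈sum (f ∘ suc))

  ∑-cong : ∀ {n} {f g : Vector Carrier n} → (∀ i → f i ≈ g i) → ∑ f ≈ ∑ g
  ∑-cong {f = f} {g} f≈g = begin
    ∑ f   ≈⟨ ∑≈sum f ⟩
    sum f ≈⟨ sum-cong-≋ f≈g ⟩
    sum g ≈⟨ ∑≈sum g ⟨
    ∑ g   ∎
    where open ≈-Reasoning

  ∑-zero : ∀ {n} {f : Vector Carrier n} → (∀ i → f i ≈ 0#) → ∑ f ≈ 0#
  ∑-zero {n} f≈0 = trans (∑-cong f≈0) (trans (∑≈sum {n} (λ _ → 0#)) (sum-replicate-zero n))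

  *-distribˡ-∑ : ∀ {n} x (f : Vector Carrier n) → x * ∑ f ≈ ∑ (λ k → x * f k)
  *-distribˡ-∑ x f = begin
    x * ∑ f                ≈⟨ *-congˡ (∑≈sum f) ⟩
    x * sum f              ≈⟨ *-distribˡ-sum x f ⟩
    sum (λ k → x * f k)    ≈⟨ ∑≈sum (λ k → x * f k) ⟨
    ∑ (λ k → x * f k)      ∎
    where open ≈-Reasoning

  *-distribʳ-∑ : ∀ {n} x (f : Vector Carrier n) → ∑ f * x ≈ ∑ (λ k → f k * x)
  *-distribʳ-∑ x f = begin
    ∑ f * x                ≈⟨ *-congʳ (∑≈sum f) ⟩
    sum f * x              ≈⟨ *-distribʳ-sum x f ⟩
    sum (λ k → f k * x)    ≈⟨ ∑≈sum (λ k → f k * x) ⟨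
    ∑ (λ k → f k * x)      ∎
    where open ≈-Reasoning

  ∑-∑-comm : ∀ {m n} (f : Fin m → Fin n → Carrier) →
             ∑ (λ i → ∑ (f i)) ≈ ∑ (λ j → ∑ (λ i → f i j))
  ∑-∑-comm f = begin
    ∑ (λ i → ∑ (f i))              ≈⟨ ∑-cong (λ i → ∑≈sum (f i)) ⟩
    ∑ (λ i → sum (f i))            ≈⟨ ∑≈sum (λ i → sum (f i)) ⟩
    sum (λ i → sum (f i))          ≈⟨ ∑-comm f ⟩
    sum (λ j → sum (λ i → f i j))  ≈⟨ ∑≈sum (λ j → sum (λ i → f i j)) ⟨
    ∑ (λ j → sum (λ i → f i j))    ≈⟨ ∑-cong (λ j → ∑≈sum (λ i → f i j)) ⟨
    ∑ (λ j → ∑ (λ i → f i j))      ∎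
    where open ≈-Reasoning

  infixl 7 _·_ _*ᵛ_ _ᵛ*_

  _·_ : ∀ {n} → Vector Carrier n → Vector Carrier n → Carrier
  u · v = ∑ (λ k → u k * v k)

  _*ᵛ_ : ∀ {n} → Mat n → Vector Carrier n → Vector Carrier n
  (A *ᵛ v) i = A i · v

  _ᵛ*_ : ∀ {n} → Vector Carrier n → Mat n → Vector Carrier n
  (v ᵛ* A) j = ∑ (λ k → v k * A k j)

  0ᵛ : ∀ {n} → Vector Carrier n
  0ᵛ _ = 0#

  ·-*ᵛ-assoc : ∀ {n} (u : Vector Carrier n) (A : Mat n) (v : Vector Carrier n) →
               u · (A *ᵛ v) ≈ (u ᵛ* A) · v
  ·-*ᵛ-assoc u A v = begin
    ∑ (λ k → u k * ∑ (λ l → A k l * v l))    ≈⟨ ∑-cong (λ k → *-distribˡ-∑ (u k) (λ l → A k l * v l)) ⟩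
    ∑ (λ k → ∑ (λ l → u k * (A k l * v l)))  ≈⟨ ∑-cong (λ k → ∑-cong (λ l → *-assoc (u k) (A k l) (v l))) ⟨
    ∑ (λ k → ∑ (λ l → u k * A k l * v l))    ≈⟨ ∑-∑-comm (λ k l → u k * A k l * v l) ⟩
    ∑ (λ l → ∑ (λ k → u k * A k l * v l))    ≈⟨ ∑-cong (λ l → *-distribʳ-∑ (v l) (λ k → u k * A k l)) ⟨
    ∑ (λ l → ∑ (λ k → u k * A k l) * v l)    ∎
    where open ≈-Reasoning

  *ᵛ-assoc : ∀ {n} (A B : Mat n) (v : Vector Carrier n) → A *ᵛ (B *ᵛ v) ≋ (A *ᴹ B) *ᵛ v
  *ᵛ-assoc A B v i = ·-*ᵛ-assoc (A i) B v

  ᵛ*-assoc : ∀ {n} (v : Vector Carrier n) (A B : Mat n) → v ᵛ* A ᵛ* B ≋ v ᵛ* (A *ᴹ B)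
  ᵛ*-assoc v A B j = sym (·-*ᵛ-assoc v A (λ k → B k j))

  *ᴹ-assoc : ∀ {n} (A B C : Mat n) → ((A *ᴹ B) *ᴹ C) ≈ᴹ (A *ᴹ (B *ᴹ C))
  *ᴹ-assoc A B C i j = sym (·-*ᵛ-assoc (A i) B (λ k → C k j))

  *ᵛ-congˡ : ∀ {n} {A B : Mat n} → A ≈ᴹ B → ∀ v → A *ᵛ v ≋ B *ᵛ v
  *ᵛ-congˡ A≈B v i = ∑-cong (λ k → *-congʳ (A≈B i k))

  ᵛ*-congʳ : ∀ {n} {A B : Mat n} → A ≈ᴹ B → ∀ v → v ᵛ* A ≋ v ᵛ* B
  ᵛ*-congʳ A≈B v j = ∑-cong (λ k → *-congˡ (A≈B k j))

  *ᴹ-congˡ : ∀ {n} (A : Mat n) {B B′ : Mat n} → B ≈ᴹ B′ → (A *ᴹ B) ≈ᴹ (A *ᴹ B′)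
  *ᴹ-congˡ A B≈B′ i j = ∑-cong (λ k → *-congˡ (B≈B′ k j))

  *ᴹ-congʳ : ∀ {n} {A A′ : Mat n} (B : Mat n) → A ≈ᴹ A′ → (A *ᴹ B) ≈ᴹ (A′ *ᴹ B)
  *ᴹ-congʳ B A≈A′ i j = ∑-cong (λ k → *-congʳ (A≈A′ i k))

  *ᵛ-identityˡ : ∀ {n} (v : Vector Carrier n) → Iᴹ *ᵛ v ≋ v
  *ᵛ-identityˡ v zero    = +-cong-identityʳ (*-identityˡ (v zero)) (∑-zero (λ k → zeroˡ (v (suc k))))
  *ᵛ-identityˡ v (suc i) = +-cong-identityˡ (zeroˡ (v zero)) (*ᵛ-identityˡ (v ∘ suc) i)

  ᵛ*-identityʳ : ∀ {n} (v : Vector Carrier n) → v ᵛ* Iᴹ ≋ v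
  ᵛ*-identityʳ v zero    = +-cong-identityʳ (*-identityʳ (v zero)) (∑-zero (λ k → zeroʳ (v (suc k))))
  ᵛ*-identityʳ v (suc j) = +-cong-identityˡ (zeroʳ (v zero)) (ᵛ*-identityʳ (v ∘ suc) j)

  *ᴹ-identityˡ : ∀ {n} (A : Mat n) → (Iᴹ *ᴹ A) ≈ᴹ A
  *ᴹ-identityˡ A i j = *ᵛ-identityˡ (λ k → A k j) i

  *ᴹ-identityʳ : ∀ {n} (A : Mat n) → (A *ᴹ Iᴹ) ≈ᴹ A
  *ᴹ-identityʳ A i = ᵛ*-identityʳ (A i)

  Mat-setoid : ℕ → Setoid r₁ r₂
  Mat-setoid n = VectorEquality.≋-setoid (VectorEquality.≋-setoid setoid n) n

  module ≈ᴹ-Reasoning {n : ℕ} = SetoidReasoning (Mat-setoid n)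
  open module ≈ᴹ {n : ℕ} = Setoid (Mat-setoid n)
    using () renaming (refl to reflᴹ; sym to symᴹ; trans to transᴹ)

  IsUnit-resp : ∀ {n} {A B : Mat n} → A ≈ᴹ B → IsUnit A → IsUnit B
  IsUnit-resp {B = B} A≈B (A⁻¹ , AA⁻¹≈I , A⁻¹A≈I) = A⁻¹ , BA⁻¹≈I , A⁻¹B≈I
    where
    BA⁻¹≈I : (B *ᴹ A⁻¹) ≈ᴹ Iᴹ
    BA⁻¹≈I = transᴹ (*ᴹ-congʳ A⁻¹ (symᴹ A≈B)) AA⁻¹≈I
    A⁻¹B≈I : (A⁻¹ *ᴹ B) ≈ᴹ Iᴹ
    A⁻¹B≈I = transᴹ (*ᴹ-congˡ A⁻¹ (symᴹ A≈B)) A⁻¹A≈I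

  rightInverse-*ᴹ : ∀ {n} {A A′ B B′ : Mat n} → (A *ᴹ A′) ≈ᴹ Iᴹ → (B *ᴹ B′) ≈ᴹ Iᴹ →
                    ((A *ᴹ B) *ᴹ (B′ *ᴹ A′)) ≈ᴹ Iᴹ
  rightInverse-*ᴹ {A = A} {A′} {B} {B′} AA′≈I BB′≈I = begin
    (A *ᴹ B) *ᴹ (B′ *ᴹ A′)  ≈⟨ *ᴹ-assoc A B (B′ *ᴹ A′) ⟩
    A *ᴹ (B *ᴹ (B′ *ᴹ A′))  ≈⟨ *ᴹ-congˡ A (*ᴹ-assoc B B′ A′) ⟨
    A *ᴹ ((B *ᴹ B′) *ᴹ A′)  ≈⟨ *ᴹ-congˡ A (*ᴹ-congʳ A′ BB′≈I) ⟩
    A *ᴹ (Iᴹ *ᴹ A′)         ≈⟨ *ᴹ-congˡ A (*ᴹ-identityˡ A′) ⟩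
    A *ᴹ A′                 ≈⟨ AA′≈I ⟩
    Iᴹ                      ∎
    where open ≈ᴹ-Reasoning

  IsUnit-* : ∀ {n} {A B : Mat n} → IsUnit A → IsUnit B → IsUnit (A *ᴹ B)
  IsUnit-* (A⁻¹ , AA⁻¹≈I , A⁻¹A≈I) (B⁻¹ , BB⁻¹≈I , B⁻¹B≈I) =
    B⁻¹ *ᴹ A⁻¹ , rightInverse-*ᴹ AA⁻¹≈I BB⁻¹≈I , rightInverse-*ᴹ B⁻¹B≈I A⁻¹A≈I

  IsUnit-+-hom : ∀ {m n} (F : Vector Carrier m → Mat n) →
                 (∀ {u v} → u ≋ v → F u ≈ᴹ F v) → F 0ᵛ ≈ᴹ Iᴹ →
                 (∀ u v → (F u *ᴹ F v) ≈ᴹ F (zipWith _+_ u v)) →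
                 ∀ u → IsUnit (F u)
  IsUnit-+-hom F F-cong F0≈I F-hom u =
    F (map -_ u) ,
    transᴹ (F-hom u (map -_ u)) (transᴹ (F-cong (λ i → -‿inverseʳ (u i))) F0≈I) ,
    transᴹ (F-hom (map -_ u) u) (transᴹ (F-cong (λ i → -‿inverseˡ (u i))) F0≈I)

  block : ∀ {n} → Carrier → Vector Carrier n → Vector Carrier n → Mat n → Mat (suc n)
  block a r c N zero    zero    = a
  block a r c N zero    (suc j) = r j
  block a r c N (suc i) zero    = c i
  block a r c N (suc i) (suc j) = N i j

  topRow leftCol : ∀ {n} → Mat (suc n) → Vector Carrier n
  topRow M j = M zero (suc j)
  leftCol M i = M (suc i) zero

  minor : ∀ {n} → Mat (suc n) → Mat n
  minor M i j = M (suc i) (suc j)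

  ≈ᴹ-block : ∀ {n} (M : Mat (suc n)) → M ≈ᴹ block (M zero zero) (topRow M) (leftCol M) (minor M)
  ≈ᴹ-block M zero    zero    = refl
  ≈ᴹ-block M zero    (suc j) = refl
  ≈ᴹ-block M (suc i) zero    = refl
  ≈ᴹ-block M (suc i) (suc j) = refl

  block-cong : ∀ {n} {a a′ : Carrier} {r r′ c c′ : Vector Carrier n} {N N′ : Mat n} →
               a ≈ a′ → r ≋ r′ → c ≋ c′ → N ≈ᴹ N′ → block a r c N ≈ᴹ block a′ r′ c′ N′
  block-cong a≈a′ r≈r′ c≈c′ N≈N′ zero    zero    = a≈a′
  block-cong a≈a′ r≈r′ c≈c′ N≈N′ zero    (suc j) = r≈r′ j
  block-cong a≈a′ r≈r′ c≈c′ N≈N′ (suc i) zero    = c≈c′ i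
  block-cong a≈a′ r≈r′ c≈c′ N≈N′ (suc i) (suc j) = N≈N′ i j

  Iᴹ-block : ∀ {n} → Iᴹ {suc n} ≈ᴹ block 1# 0ᵛ 0ᵛ Iᴹ
  Iᴹ-block zero    zero    = refl
  Iᴹ-block zero    (suc j) = refl
  Iᴹ-block (suc i) zero    = refl
  Iᴹ-block (suc i) (suc j) = refl

  block-diagonal-*ᴹ : ∀ {n} (a b : Carrier) (N N′ : Mat n) →
                      (block a 0ᵛ 0ᵛ N *ᴹ block b 0ᵛ 0ᵛ N′) ≈ᴹ block (a * b) 0ᵛ 0ᵛ (N *ᴹ N′)
  block-diagonal-*ᴹ {n} a b N N′ zero    zero    = +-cong-identityʳ refl (∑-zero {n} (λ _ → zeroˡ 0#))
  block-diagonal-*ᴹ     a b N N′ zero    (suc j) = +-cong-identityʳ (zeroʳ a) (∑-zero (λ k → zeroˡ (N′ k j)))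
  block-diagonal-*ᴹ     a b N N′ (suc i) zero    = +-cong-identityʳ (zeroˡ b) (∑-zero (λ k → zeroʳ (N i k)))
  block-diagonal-*ᴹ     a b N N′ (suc i) (suc j) = +-cong-identityˡ (zeroˡ 0#) refl

  block-diagonal-IsUnit : ∀ {n} {a τ : Carrier} {N : Mat n} → a * τ ≈ 1# → IsUnit N →
                          IsUnit (block a 0ᵛ 0ᵛ N)
  block-diagonal-IsUnit {a = a} {τ} {N} aτ≈1 (N⁻¹ , NN⁻¹≈I , N⁻¹N≈I) =
    block τ 0ᵛ 0ᵛ N⁻¹ ,
    transᴹ (block-diagonal-*ᴹ a τ N N⁻¹) (transᴹ (block-cong aτ≈1 ≋-refl ≋-refl NN⁻¹≈I) (symᴹ Iᴹ-block)) ,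
    transᴹ (block-diagonal-*ᴹ τ a N⁻¹ N) (transᴹ (block-cong τa≈1 ≋-refl ≋-refl N⁻¹N≈I) (symᴹ Iᴹ-block))
    where
    τa≈1 : τ * a ≈ 1#
    τa≈1 = trans (*-comm τ a) aτ≈1

  upperUnitriangular lowerUnitriangular : ∀ {n} → Vector Carrier n → Mat (suc n)
  upperUnitriangular r = block 1# r 0ᵛ Iᴹ
  lowerUnitriangular c = block 1# 0ᵛ c Iᴹ

  upperUnitriangular-*ᴹ : ∀ {n} (u v : Vector Carrier n) →
    (upperUnitriangular u *ᴹ upperUnitriangular v) ≈ᴹ upperUnitriangular (zipWith _+_ u v)
  upperUnitriangular-*ᴹ u v zero    zero    = +-cong-identityʳ (*-identityˡ 1#) (∑-zero (λ k → zeroʳ (u k)))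
  upperUnitriangular-*ᴹ u v zero    (suc j) =
    trans (+-cong (*-identityˡ (v j)) (ᵛ*-identityʳ u j)) (+-comm (v j) (u j))
  upperUnitriangular-*ᴹ u v (suc i) zero    = +-cong-identityʳ (zeroˡ 1#) (*ᵛ-identityˡ 0ᵛ i)
  upperUnitriangular-*ᴹ u v (suc i) (suc j) = +-cong-identityˡ (zeroˡ (v j)) (*ᴹ-identityˡ Iᴹ i j)

  lowerUnitriangular-*ᴹ : ∀ {n} (u v : Vector Carrier n) →
    (lowerUnitriangular u *ᴹ lowerUnitriangular v) ≈ᴹ lowerUnitriangular (zipWith _+_ u v)
  lowerUnitriangular-*ᴹ u v zero    zero    = +-cong-identityʳ (*-identityˡ 1#) (∑-zero (λ k → zeroˡ (v k)))
  lowerUnitriangular-*ᴹ u v zero    (suc j) = +-cong-identityʳ (zeroʳ 1#) (ᵛ*-identityʳ 0ᵛ j)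
  lowerUnitriangular-*ᴹ u v (suc i) zero    = +-cong (*-identityʳ (u i)) (*ᵛ-identityˡ v i)
  lowerUnitriangular-*ᴹ u v (suc i) (suc j) = +-cong-identityˡ (zeroʳ (u i)) (*ᴹ-identityˡ Iᴹ i j)

  upperUnitriangular-IsUnit : ∀ {n} (u : Vector Carrier n) → IsUnit (upperUnitriangular u)
  upperUnitriangular-IsUnit = IsUnit-+-hom upperUnitriangular
    (λ u≈v → block-cong refl u≈v ≋-refl reflᴹ) (symᴹ Iᴹ-block) upperUnitriangular-*ᴹ

  lowerUnitriangular-IsUnit : ∀ {n} (u : Vector Carrier n) → IsUnit (lowerUnitriangular u)
  lowerUnitriangular-IsUnit = IsUnit-+-hom lowerUnitriangular
    (λ u≈v → block-cong refl ≋-refl u≈v reflᴹ) (symᴹ Iᴹ-block) lowerUnitriangular-*ᴹ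

  *ᵛ-cancelˡ : ∀ {n} {N P : Mat n} → (N *ᴹ P) ≈ᴹ Iᴹ → ∀ v → N *ᵛ (P *ᵛ v) ≋ v
  *ᵛ-cancelˡ {N = N} {P} NP≈I v i =
    trans (*ᵛ-assoc N P v i) (trans (*ᵛ-congˡ NP≈I v i) (*ᵛ-identityˡ v i))

  ᵛ*-cancelʳ : ∀ {n} {N P : Mat n} → (P *ᴹ N) ≈ᴹ Iᴹ → ∀ v → v ᵛ* P ᵛ* N ≋ v
  ᵛ*-cancelʳ {N = N} {P} PN≈I v j =
    trans (ᵛ*-assoc v P N j) (trans (ᵛ*-congʳ PN≈I v j) (ᵛ*-identityʳ v j))

  block-diagonal-*-lowerUnitriangular :
    ∀ {n} (σ : Carrier) (c : Vector Carrier n) {N P : Mat n} → (N *ᴹ P) ≈ᴹ Iᴹ →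
    (block σ 0ᵛ 0ᵛ N *ᴹ lowerUnitriangular (P *ᵛ c)) ≈ᴹ block σ 0ᵛ c N
  block-diagonal-*-lowerUnitriangular σ c {P = P} NP≈I zero zero =
    +-cong-identityʳ (*-identityʳ σ) (∑-zero (λ k → zeroˡ ((P *ᵛ c) k)))
  block-diagonal-*-lowerUnitriangular σ c NP≈I zero (suc j) =
    +-cong-identityʳ (zeroʳ σ) (ᵛ*-identityʳ 0ᵛ j)
  block-diagonal-*-lowerUnitriangular σ c NP≈I (suc i) zero =
    +-cong-identityˡ (zeroˡ 1#) (*ᵛ-cancelˡ NP≈I c i)
  block-diagonal-*-lowerUnitriangular σ c {N} NP≈I (suc i) (suc j) =
    +-cong-identityˡ (zeroˡ 0#) (*ᴹ-identityʳ N i j)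

  upperUnitriangular-*-block :
    ∀ {n} (σ : Carrier) (r c : Vector Carrier n) {N P : Mat n} → (P *ᴹ N) ≈ᴹ Iᴹ →
    (upperUnitriangular (r ᵛ* P) *ᴹ block σ 0ᵛ c N) ≈ᴹ block (σ + r · (P *ᵛ c)) r c N
  upperUnitriangular-*-block σ r c {P = P} PN≈I zero zero =
    +-cong (*-identityˡ σ) (sym (·-*ᵛ-assoc r P c))
  upperUnitriangular-*-block σ r c PN≈I zero (suc j) =
    +-cong-identityˡ (zeroʳ 1#) (ᵛ*-cancelʳ PN≈I r j)
  upperUnitriangular-*-block σ r c PN≈I (suc i) zero =
    +-cong-identityˡ (zeroˡ σ) (*ᵛ-identityˡ c i)
  upperUnitriangular-*-block σ r c {N} PN≈I (suc i) (suc j) =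
    +-cong-identityˡ (zeroˡ 0#) (*ᴹ-identityˡ N i j)

  schurComplement : ∀ {n} → Mat (suc n) → Mat n → Carrier
  schurComplement M P = M zero zero - topRow M · (P *ᵛ leftCol M)

  schur-factorisation :
    ∀ {n} (M : Mat (suc n)) {P : Mat n} → (minor M *ᴹ P) ≈ᴹ Iᴹ → (P *ᴹ minor M) ≈ᴹ Iᴹ →
    (upperUnitriangular (topRow M ᵛ* P) *ᴹ
      (block (schurComplement M P) 0ᵛ 0ᵛ (minor M) *ᴹ lowerUnitriangular (P *ᵛ leftCol M))) ≈ᴹ M
  schur-factorisation M {P} NP≈I PN≈I = begin
    U *ᴹ (block σ 0ᵛ 0ᵛ N *ᴹ lowerUnitriangular (P *ᵛ c))
      ≈⟨ *ᴹ-congˡ U (block-diagonal-*-lowerUnitriangular σ c NP≈I) ⟩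
    U *ᴹ block σ 0ᵛ c N
      ≈⟨ upperUnitriangular-*-block σ r c PN≈I ⟩
    block (σ + r · (P *ᵛ c)) r c N
      ≈⟨ block-cong (//-rightDividesˡ (r · (P *ᵛ c)) (M zero zero)) ≋-refl ≋-refl reflᴹ ⟩
    block (M zero zero) r c N
      ≈⟨ ≈ᴹ-block M ⟨
    M ∎
    where
    open ≈ᴹ-Reasoning
    σ = schurComplement M P
    r = topRow M
    c = leftCol M
    N = minor M
    U = upperUnitriangular (r ᵛ* P)

  schur-IsUnit : ∀ {n} (M : Mat (suc n)) {P : Mat n} {τ : Carrier} →
                 (minor M *ᴹ P) ≈ᴹ Iᴹ → (P *ᴹ minor M) ≈ᴹ Iᴹ → schurComplement M P * τ ≈ 1# →
                 IsUnit M
  schur-IsUnit M {P} NP≈I PN≈I στ≈1 =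
    IsUnit-resp (schur-factorisation M NP≈I PN≈I)
      (IsUnit-* {A = U} {B = D *ᴹ L} (upperUnitriangular-IsUnit (topRow M ᵛ* P))
        (IsUnit-* {A = D} {B = L} (block-diagonal-IsUnit στ≈1 (P , NP≈I , PN≈I))
                                  (lowerUnitriangular-IsUnit (P *ᵛ leftCol M))))
    where
    U = upperUnitriangular (topRow M ᵛ* P)
    D = block (schurComplement M P) 0ᵛ 0ᵛ (minor M)
    L = lowerUnitriangular (P *ᵛ leftCol M)

  Iᴹ-diagonal : ∀ {n} (i : Fin n) → Iᴹ i i ≈ 1#
  Iᴹ-diagonal zero    = refl
  Iᴹ-diagonal (suc i) = Iᴹ-diagonal i

  zeroRow⇒¬IsUnit : ¬ 1# ≈ 0# → ∀ {n} {A : Mat n} (i : Fin n) → (∀ k → A i k ≈ 0#) → ¬ IsUnit A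
  zeroRow⇒¬IsUnit 1≉0 {A = A} i rowᵢ≈0 (B , AB≈I , _) = 1≉0 (begin
    1#              ≈⟨ Iᴹ-diagonal i ⟨
    Iᴹ i i          ≈⟨ AB≈I i i ⟨
    (A *ᴹ B) i i    ≈⟨ ∑-zero (λ k → trans (*-congʳ (rowᵢ≈0 k)) (zeroˡ (B k i))) ⟩
    0#              ∎)
    where open ≈-Reasoning

  signDiag-cong : ∀ {n} {s t : Fin n → Bool} → (∀ i → s i ≡ t i) → signDiag s ≈ᴹ signDiag t
  signDiag-cong s≗t i j rewrite s≗t i = refl

  signDiag-+-row : ∀ {n} (s t : Fin n → Bool) {i : Fin n} → s i ≢ t i →
                   ∀ k → signDiag s i k + signDiag t i k ≈ 0#
  signDiag-+-row s t {i} sᵢ≢tᵢ k with does (i Fin.≟ k) | s i | t i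
  ... | false | _     | _     = +-identityʳ 0#
  ... | true  | true  | true  = ⊥-elim (sᵢ≢tᵢ ≡.refl)
  ... | true  | false | false = ⊥-elim (sᵢ≢tᵢ ≡.refl)
  ... | true  | true  | false = -‿inverseʳ 1#
  ... | true  | false | true  = -‿inverseˡ 1#

  𝒮-independent : ¬ 1# ≈ 0# → ∀ {n} → IsIndependent (𝒮 n)
  𝒮-independent 1≉0 A B (lift (s , A≈s)) (lift (t , B≈t)) (A≉B , A+B-unit) =
    A≉B (λ i j → trans (A≈s i j) (trans (signDiag-cong s≗t i j) (sym (B≈t i j))))
    where
    s≗t : ∀ i → s i ≡ t i
    s≗t i with s i Bool.≟ t i
    ... | yes sᵢ≡tᵢ = sᵢ≡tᵢ
    ... | no  sᵢ≢tᵢ = ⊥-elim (zeroRow⇒¬IsUnit 1≉0 i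
            (λ k → trans (+-cong (A≈s i k) (B≈t i k)) (signDiag-+-row s t sᵢ≢tᵢ k)) A+B-unit)

  ±1-shift-nonzero : CharNot2 R → ∀ a x → a + 1# - x ≈ 0# → ¬ (a + - 1# - x ≈ 0#)
  ±1-shift-nonzero char≢2 a x a+1-x≈0 a-1-x≈0 = char≢2 (begin
    1# + 1#    ≈⟨ +-congˡ 1≈-1 ⟩
    1# + - 1#  ≈⟨ -‿inverseʳ 1# ⟩
    0#         ∎)
    where
    open ≈-Reasoning
    1≈-1 : 1# ≈ - 1#
    1≈-1 = ∙-cancelˡ a 1# (- 1#)
             (trans (x∙y⁻¹≈ε⇒x≈y _ x a+1-x≈0) (sym (x∙y⁻¹≈ε⇒x≈y _ x a-1-x≈0)))

module _ {r₁ r₂ : Level} {R : CommutativeRing r₁ r₂}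
         (isField : IsFiniteField R) (char≢2 : CharNot2 R) where
  open CommutativeRing R hiding (zero)
  open MatrixOps R
  open MatrixProperties R
  open IsFiniteField isField using (inverse; _≟_)

  -- The sign d only enters the corner entry, so the two candidate complements differ by 2.
  schurComplement-nonzero-for-some-sign :
    ∀ {n} (A : Mat (suc n)) (s : Fin n → Bool) (P : Mat n) →
    Σ Bool λ d → ¬ schurComplement (A +ᴹ signDiag (d ∷ s)) P ≈ 0#
  schurComplement-nonzero-for-some-sign A s P
    with schurComplement (A +ᴹ signDiag (true ∷ s)) P ≟ 0#
  ... | no  σ₊≉0 = true , σ₊≉0
  ... | yes σ₊≈0 = false , ±1-shift-nonzero char≢2 _ _ σ₊≈0

  signDiag-shift-IsUnit : ∀ n (A : Mat n) → Σ (Fin n → Bool) λ s → IsUnit (A +ᴹ signDiag s)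
  signDiag-shift-IsUnit zero    A = (λ ()) , (λ ()) , (λ ()) , (λ ())
  signDiag-shift-IsUnit (suc n) A =
    let s , P , NP≈I , PN≈I = signDiag-shift-IsUnit n (minor A)
        d , σ≉0             = schurComplement-nonzero-for-some-sign A s P
        τ , στ≈1            = inverse _ σ≉0
    in d ∷ s , schur-IsUnit (A +ᴹ signDiag (d ∷ s)) NP≈I PN≈I στ≈1

  𝒮-dominating : ∀ {n} (A : Mat n) → ¬ 𝒮 n A → Σ (Mat n) λ B → 𝒮 n B × Adjacent A B
  𝒮-dominating {n} A A∉𝒮 =
    let s , A+s-unit = signDiag-shift-IsUnit n A
    in signDiag s , lift (s , λ _ _ → refl) , (λ A≈s → A∉𝒮 (lift (s , A≈s))) , A+s-unit

lemma2p3 : {c ℓ : Level} (F : CommutativeRing c ℓ) → IsFiniteField F → CharNot2 F →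
    (n : ℕ) → n ≥ 1 → MatrixOps.IsMaximalIndependent F (MatrixOps.𝒮 F n)
lemma2p3 F isField char≢2 n _ =
  MatrixProperties.𝒮-independent F (IsFiniteField.nontrivial isField) , 𝒮-dominating isField char≢2
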